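{- Let $r\geq 2$, $n\geq r$ and $m\geq t_r(n)$, and let $G$ be a graph with $n$ vertices and $m$ edges which is not regular. Then there exists a $\mathfrak{P}$-sequence of $G$ whose first $r$ terms $v_1,\dots,v_r$ satisfy $$\sum_{i=1}^{r} d(v_i)>\frac{2rm}{n}.$$
   Context: Graphs are finite and simple. $d(u)$ denotes the degree of a vertex $u$ and $\Gamma(u)$ its neighbourhood; for a set $U$ of vertices, $\widehat{\Gamma}(U)=\bigcap_{v\in U}\Gamma(v)$. $t_r(n)$ is the number of edges of the $r$-partite Turán graph on $n$ vertices (complete $r$-partite graph with part sizes differing by at most one). The greedy algorithm $\mathfrak{P}$ constructs a clique $v_1,\dots,v_k$ in $G$: $v_1$ is a vertex of maximum degree in $G$; having selected $v_1,\dots,v_{i-1}$, if $\widehat{\Gamma}(\{v_1,\dots,v_{i-1}\})=\varnothing$ it stops, otherwise it selects $v_i$ to be a vertex of maximum degree (in $G$) among the vertices of $\widehat{\Gamma}(\{v_1,\dots,v_{i-1}\})$, and repeats. Any sequence that can be produced by $\mathfrak{P}$ (with arbitrary tie-breaking) is called a $\mathfrak{P}$-sequence. -}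

module Defs where

open import Data.Nat using (ℕ; zero; suc; _+_; _*_; _≤_; _<_; _<ᵇ_; _≡ᵇ_; _%_)
open import Data.Bool using (Bool; true; false; _∧_; not; if_then_else_)
open import Data.Fin using (Fin; toℕ)
open import Data.List using (List; []; _∷_; _++_; [_]; map; allFin; length; take)
open import Data.Nat.ListAction using (sum)
open import Data.List.Relation.Unary.All using (All)
open import Data.Product using (_×_)
open import Relation.Binary.PropositionalEquality using (_≡_)
open import Relation.Nullary using (¬_)

record Graph (n : ℕ) : Set where
  field
    adj    : Fin n → Fin n → Bool
    sym    : ∀ i j → adj i j ≡ adj j i
    irrefl : ∀ i → adj i i ≡ false
open Graph public

edgeCountAdj : {n : ℕ} → (Fin n → Fin n → Bool) → ℕ
edgeCountAdj {n} a =
  sum (map (λ i → sum (map (λ j → if a i j ∧ (toℕ i <ᵇ toℕ j) then 1 else 0) (allFin n))) (allFin n))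

edges : {n : ℕ} → Graph n → ℕ
edges G = edgeCountAdj (adj G)

deg : {n : ℕ} → Graph n → Fin n → ℕ
deg {n} G u = sum (map (λ v → if adj G u v then 1 else 0) (allFin n))

Regular : {n : ℕ} → Graph n → Set
Regular G = ∀ u v → deg G u ≡ deg G v

-- t_r(n): edges of the r-partite Turán graph on n vertices;
-- vertex i lies in part (i mod r), so part sizes differ by at most one.
turan : ℕ → ℕ → ℕ
turan zero    n = 0
turan (suc k) n = edgeCountAdj {n} (λ i j → not ((toℕ i % suc k) ≡ᵇ (toℕ j % suc k)))

-- w ∈ Γ̂(pre)  (for pre = [] this holds for every w)
InCommonNbr : {n : ℕ} → Graph n → List (Fin n) → Fin n → Set
InCommonNbr G pre w = All (λ v → adj G v w ≡ true) pre

-- Greedy G pre rest : having chosen pre, the algorithm 𝔓 can continue with exactly rest.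
Greedy : {n : ℕ} → Graph n → List (Fin n) → List (Fin n) → Set
Greedy G pre []         = ∀ w → ¬ InCommonNbr G pre w
Greedy G pre (v ∷ rest) =
  InCommonNbr G pre v
  × (∀ w → InCommonNbr G pre w → deg G w ≤ deg G v)
  × Greedy G (pre ++ [ v ]) rest

PSeq : {n : ℕ} → Graph n → List (Fin n) → Set
PSeq G vs = Greedy G [] vs

{-# OPTIONS --safe #-}
-- Write e(u) = n − d(u) for the number of non-neighbours of u (u included), so ∑ e = n² − 2m =: N and the
-- claim reads n (e(v₁) + ⋯ + e(v_r)) < r N. A vertex outside the common neighbourhood of v₁, …, v_j misses
-- some v_i that was chosen while it was still a candidate. Hence, if e(v_i) ≤ x ≤ e(u) for all i ≤ j and
-- all common neighbours u,
--   n x + ∑_{i≤j} e(v_i)² ≤ N + x ∑_{i≤j} e(v_i).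
-- Since m ≥ t_r(n), N + r q (q + 1) ≤ (2q + 1) n for q = ⌊n/r⌋; together with (a − q)(a − q − 1) ≥ 0 this
-- keeps ∑_{i≤j} e(v_i) below n for j < r, so the sequence has at least r terms. At j = r, an integral
-- Cauchy–Schwarz inequality and n e(v₁) < N (v₁ has maximum degree and G is not regular) give the claim.
module Submission where

open import Data.Bool using (Bool; true; false; _∧_; not; if_then_else_)
open import Data.Bool.Properties using (∧-zeroʳ; ∧-identityʳ) renaming (_≟_ to _≟ᴮ_)
open import Data.Fin using (Fin; zero; suc; toℕ; fromℕ<)
open import Data.Fin.Properties using (toℕ<n; ¬∀⟶∃¬) renaming (<-cmp to <-cmpᶠ)
open import Data.List using (List; []; _∷_; _++_; [_]; map; allFin; tabulate; length; take)
open import Data.List.Properties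
  using (length-take; map-tabulate; map-++; ++-assoc; ++-identityʳ; length-++-sucʳ; length-++-≤ˡ; length-map)
open import Data.List.Relation.Unary.All as All using (All; []; _∷_; all?)
open import Data.List.Relation.Unary.All.Properties using (++⁺; ++⁻ˡ; ++⁻ʳ; map⁺)
open import Data.Nat
open import Data.Nat.DivMod using (m<n⇒m%n≡m; m%n<n; [m+n]%n≡m%n; m≡m%n+[m/n]*n; m≥n⇒m/n>0)
open import Data.Nat.ListAction using (sum)
open import Data.Nat.ListAction.Properties using (sum-++)
open import Data.Nat.Properties
open import Data.Nat.Tactic.RingSolver using (solve-∀)
open import Data.Product using (Σ; _×_; _,_; proj₁; proj₂)
open import Data.Sum using (_⊎_; inj₁; inj₂; [_,_]′)
open import Function using (_∘_; id)
open import Relation.Binary.PropositionalEquality hiding ([_])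
open import Relation.Binary.Definitions using (tri<; tri≈; tri>)
open import Relation.Nullary using (¬_; Dec; does; yes; no; contradiction)
open import Relation.Nullary.Decidable using (dec-false; dec-true)
open import Algebra.Properties.Semiring.Sum +-*-semiring
  using (sum-syntax; ∑-distrib-+; ∑-comm; sum-cong-≗; *-distribʳ-sum) renaming (sum to ∑)
open import Defs hiding (sym)

⟦_⟧ : Bool → ℕ
⟦ b ⟧ = if b then 1 else 0

⟦⟧≤1 : ∀ b → ⟦ b ⟧ ≤ 1
⟦⟧≤1 true  = ≤-refl
⟦⟧≤1 false = z≤n

⟦not⟧+⟦⟧≡1 : ∀ b → ⟦ not b ⟧ + ⟦ b ⟧ ≡ 1
⟦not⟧+⟦⟧≡1 true  = refl
⟦not⟧+⟦⟧≡1 false = refl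

<⇒<ᵇ≡true : ∀ {a b} → a < b → (a <ᵇ b) ≡ true
<⇒<ᵇ≡true {a} {b} = dec-true (a <? b)

≤⇒<ᵇ≡false : ∀ {a b} → b ≤ a → (a <ᵇ b) ≡ false
≤⇒<ᵇ≡false {a} {b} b≤a = dec-false (a <? b) (≤⇒≯ b≤a)

-- Finite sums

∑-const : ∀ n c → ∑[ i < n ] c ≡ n * c
∑-const zero    c = refl
∑-const (suc n) c = cong (c +_) (∑-const n c)

∑-mono-≤ : ∀ {n} {f g : Fin n → ℕ} → (∀ i → f i ≤ g i) → ∑ f ≤ ∑ g
∑-mono-≤ {zero}  f≤g = z≤n
∑-mono-≤ {suc n} f≤g = +-mono-≤ (f≤g zero) (∑-mono-≤ (f≤g ∘ suc))

∑-mono-< : ∀ {n} {f g : Fin n → ℕ} → (∀ i → f i ≤ g i) → ∀ k → f k < g k → ∑ f < ∑ g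
∑-mono-< {suc n} f≤g zero    fk<gk = +-mono-<-≤ fk<gk (∑-mono-≤ (f≤g ∘ suc))
∑-mono-< {suc n} f≤g (suc k) fk<gk = +-mono-≤-< (f≤g zero) (∑-mono-< (f≤g ∘ suc) k fk<gk)

sum-map-allFin : ∀ n (f : Fin n → ℕ) → sum (map f (allFin n)) ≡ ∑ f
sum-map-allFin n f = trans (cong sum (map-tabulate id f)) (sum-tabulate n f)
  where
  sum-tabulate : ∀ n (f : Fin n → ℕ) → sum (tabulate f) ≡ ∑ f
  sum-tabulate zero    f = refl
  sum-tabulate (suc n) f = cong (f zero +_) (sum-tabulate n (f ∘ suc))

edgeCountAdj≡∑∑ : ∀ {n} (a : Fin n → Fin n → Bool) →
  edgeCountAdj a ≡ ∑[ i < n ] ∑[ j < n ] ⟦ a i j ∧ (toℕ i <ᵇ toℕ j) ⟧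
edgeCountAdj≡∑∑ {n} a =
  trans (sum-map-allFin n _) (sum-cong-≗ {n} (λ i → sum-map-allFin n _))

∑ℕ : ℕ → (ℕ → ℕ) → ℕ
∑ℕ n f = ∑[ i < n ] f (toℕ i)

∑ℕ-cong : ∀ n {f g : ℕ → ℕ} → (∀ k → k < n → f k ≡ g k) → ∑ℕ n f ≡ ∑ℕ n g
∑ℕ-cong n f≡g = sum-cong-≗ (λ i → f≡g (toℕ i) (toℕ<n i))

∑ℕ-+ : ∀ n (f g : ℕ → ℕ) → ∑ℕ n (λ k → f k + g k) ≡ ∑ℕ n f + ∑ℕ n g
∑ℕ-+ n f g = ∑-distrib-+ {n} (f ∘ toℕ) (g ∘ toℕ)

∑ℕ-split : ∀ a b (f : ℕ → ℕ) → ∑ℕ (a + b) f ≡ ∑ℕ a f + ∑ℕ b (λ k → f (a + k))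
∑ℕ-split zero    b f = refl
∑ℕ-split (suc a) b f = trans (cong (f 0 +_) (∑ℕ-split a b (f ∘ suc))) (sym (+-assoc (f 0) _ _))

∑ℕ-suc : ∀ n (f : ℕ → ℕ) → ∑ℕ (suc n) f ≡ ∑ℕ n f + f n
∑ℕ-suc zero    f = +-identityʳ (f 0)
∑ℕ-suc (suc n) f = trans (cong (f 0 +_) (∑ℕ-suc n (f ∘ suc))) (sym (+-assoc (f 0) _ _))

∑ℕ-≡ᵇ : ∀ r c → c < r → ∑ℕ r (λ a → ⟦ a ≡ᵇ c ⟧) ≡ 1
∑ℕ-≡ᵇ (suc r) zero    _         = cong suc (trans (∑-const r 0) (*-zeroʳ r))
∑ℕ-≡ᵇ (suc r) (suc c) (s<s c<r) = ∑ℕ-≡ᵇ r c c<r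

empty-or-argmax : ∀ {m} (P : Fin m → Set) → (∀ w → Dec (P w)) → (f : Fin m → ℕ) →
  (∀ w → ¬ P w) ⊎ Σ (Fin m) (λ v → P v × (∀ w → P w → f w ≤ f v))
empty-or-argmax {zero}  P P? f = inj₁ (λ ())
empty-or-argmax {suc m} P P? f with empty-or-argmax (P ∘ suc) (P? ∘ suc) (f ∘ suc) | P? zero
... | inj₁ none           | no ¬p0 = inj₁ λ { zero → ¬p0 ; (suc w) → none w }
... | inj₁ none           | yes p0 = inj₂ (zero , p0 , λ { zero _ → ≤-refl ; (suc w) pw → contradiction pw (none w) })
... | inj₂ (v , pv , max) | no ¬p0 = inj₂ (suc v , pv , λ { zero p0 → contradiction p0 ¬p0 ; (suc w) pw → max w pw })
... | inj₂ (v , pv , max) | yes p0 with f zero ≤? f (suc v)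
...   | yes f0≤fv = inj₂ (suc v , pv , λ { zero _ → f0≤fv ; (suc w) pw → max w pw })
...   | no  f0≰fv =
  inj₂ (zero , p0 , λ { zero _ → ≤-refl ; (suc w) pw → ≤-trans (max w pw) (<⇒≤ (≰⇒> f0≰fv)) })

take-suc-length-++ : ∀ {A : Set} (xs : List A) y ys → take (suc (length xs)) (xs ++ y ∷ ys) ≡ xs ++ [ y ]
take-suc-length-++ []       y ys = refl
take-suc-length-++ (x ∷ xs) y ys = cong (x ∷_) (take-suc-length-++ xs y ys)

-- The Turán number

-- Parametrised by k rather than r = suc k so that turan r n unfolds.
module TuránCount (k : ℕ) where

  r : ℕ
  r = suc k

  sameClass : ℕ → ℕ → Bool
  sameClass a b = a % r ≡ᵇ b % r

  classRank : ℕ → ℕ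
  classRank b = ∑ℕ b (λ a → ⟦ sameClass a b ⟧)

  classRank-< : ∀ s → s < r → classRank s ≡ 0
  classRank-< s s<r = trans (∑ℕ-cong s below) (trans (∑-const s 0) (*-zeroʳ s))
    where
    below : ∀ a → a < s → ⟦ sameClass a s ⟧ ≡ 0
    below a a<s = cong ⟦_⟧ (begin
      a % r ≡ᵇ s % r ≡⟨ cong₂ _≡ᵇ_ (m<n⇒m%n≡m (<-trans a<s s<r)) (m<n⇒m%n≡m s<r) ⟩
      a ≡ᵇ s         ≡⟨ dec-false (a ≟ s) (<⇒≢ a<s) ⟩
      false          ∎)
      where open ≡-Reasoning

  classRank-r+ : ∀ m → classRank (r + m) ≡ suc (classRank m)
  classRank-r+ m = begin
    ∑ℕ (r + m) (λ a → ⟦ sameClass a (r + m) ⟧)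
      ≡⟨ ∑ℕ-split r m (λ a → ⟦ sameClass a (r + m) ⟧) ⟩
    ∑ℕ r (λ a → ⟦ sameClass a (r + m) ⟧) + ∑ℕ m (λ a → ⟦ sameClass (r + a) (r + m) ⟧)
      ≡⟨ cong₂ _+_ (trans (∑ℕ-cong r first-period) (∑ℕ-≡ᵇ r (m % r) (m%n<n m r)))
                   (∑ℕ-cong m (λ a _ → cong ⟦_⟧ (cong₂ _≡ᵇ_ (r+m%r a) (r+m%r m)))) ⟩
    suc (classRank m) ∎
    where
    open ≡-Reasoning
    r+m%r : ∀ m → (r + m) % r ≡ m % r
    r+m%r m = trans (cong (_% r) (+-comm r m)) ([m+n]%n≡m%n m r)
    first-period : ∀ a → a < r → ⟦ sameClass a (r + m) ⟧ ≡ ⟦ a ≡ᵇ m % r ⟧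
    first-period a a<r = cong ⟦_⟧ (cong₂ _≡ᵇ_ (m<n⇒m%n≡m a<r) (r+m%r m))

  classRank-s+q*r : ∀ q s → s < r → classRank (s + q * r) ≡ q
  classRank-s+q*r zero    s s<r = trans (cong classRank (+-identityʳ s)) (classRank-< s s<r)
  classRank-s+q*r (suc q) s s<r = begin
    classRank (s + (r + q * r)) ≡⟨ cong classRank (+-comm-left s r (q * r)) ⟩
    classRank (r + (s + q * r)) ≡⟨ classRank-r+ (s + q * r) ⟩
    suc (classRank (s + q * r)) ≡⟨ cong suc (classRank-s+q*r q s s<r) ⟩
    suc q                       ∎
    where
    open ≡-Reasoning
    +-comm-left : ∀ a b c → a + (b + c) ≡ b + (a + c)
    +-comm-left = solve-∀

  sameClassPairs : ℕ → ℕ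
  sameClassPairs n = ∑ℕ n classRank

  sameClassPairs-q*r+s : ∀ q s → s ≤ r → sameClassPairs (q * r + s) ≡ sameClassPairs (q * r) + s * q
  sameClassPairs-q*r+s q s s≤r = begin
    ∑ℕ (q * r + s) classRank                      ≡⟨ ∑ℕ-split (q * r) s classRank ⟩
    sameClassPairs (q * r) + ∑ℕ s (λ j → classRank (q * r + j))
      ≡⟨ cong (sameClassPairs (q * r) +_) (∑ℕ-cong s last-period) ⟩
    sameClassPairs (q * r) + ∑ℕ s (λ _ → q)     ≡⟨ cong (sameClassPairs (q * r) +_) (∑-const s q) ⟩
    sameClassPairs (q * r) + s * q                ∎
    where
    open ≡-Reasoning
    last-period : ∀ j → j < s → classRank (q * r + j) ≡ q
    last-period j j<s = trans (cong classRank (+-comm (q * r) j)) (classRank-s+q*r q j (<-≤-trans j<s s≤r))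

  sameClassPairs-q*r : ∀ q → 2 * sameClassPairs (q * r) + r * q ≡ r * q * q
  sameClassPairs-q*r zero    = trans (*-zeroʳ r) (sym (*-zeroʳ (r * 0)))
  sameClassPairs-q*r (suc q) = begin
    2 * sameClassPairs (r + q * r) + r * suc q
      ≡⟨ cong (λ t → 2 * t + r * suc q)
              (trans (cong sameClassPairs (+-comm r (q * r))) (sameClassPairs-q*r+s q r ≤-refl)) ⟩
    2 * (sameClassPairs (q * r) + r * q) + r * suc q
      ≡⟨ regroup (sameClassPairs (q * r)) r q ⟩
    (2 * sameClassPairs (q * r) + r * q) + (2 * (r * q) + r)
      ≡⟨ cong (_+ (2 * (r * q) + r)) (sameClassPairs-q*r q) ⟩
    r * q * q + (2 * (r * q) + r)
      ≡⟨ square-suc r q ⟩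
    r * suc q * suc q ∎
    where
    open ≡-Reasoning
    regroup : ∀ t r q → 2 * (t + r * q) + r * suc q ≡ (2 * t + r * q) + (2 * (r * q) + r)
    regroup = solve-∀
    square-suc : ∀ r q → r * q * q + (2 * (r * q) + r) ≡ r * suc q * suc q
    square-suc = solve-∀

  sameClassPairs-closed : ∀ q s → s ≤ r →
    2 * sameClassPairs (q * r + s) + (q * r + s) + r * (q * suc q) ≡ (2 * q + 1) * (q * r + s)
  sameClassPairs-closed q s s≤r = begin
    2 * sameClassPairs (q * r + s) + (q * r + s) + r * (q * suc q)
      ≡⟨ cong (λ t → 2 * t + (q * r + s) + r * (q * suc q)) (sameClassPairs-q*r+s q s s≤r) ⟩
    2 * (sameClassPairs (q * r) + s * q) + (q * r + s) + r * (q * suc q)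
      ≡⟨ regroup (sameClassPairs (q * r)) q s r ⟩
    (2 * sameClassPairs (q * r) + r * q) + (2 * (s * q) + s + q * r + r * q * q)
      ≡⟨ cong (_+ (2 * (s * q) + s + q * r + r * q * q)) (sameClassPairs-q*r q) ⟩
    r * q * q + (2 * (s * q) + s + q * r + r * q * q)
      ≡⟨ collect q s r ⟩
    (2 * q + 1) * (q * r + s) ∎
    where
    open ≡-Reasoning
    regroup : ∀ t q s r → 2 * (t + s * q) + (q * r + s) + r * (q * suc q)
                        ≡ (2 * t + r * q) + (2 * (s * q) + s + q * r + r * q * q)
    regroup = solve-∀
    collect : ∀ q s r → r * q * q + (2 * (s * q) + s + q * r + r * q * q) ≡ (2 * q + 1) * (q * r + s)
    collect = solve-∀

  crossBefore : ℕ → ℕ → ℕ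
  crossBefore a b = ⟦ not (sameClass a b) ∧ (a <ᵇ b) ⟧

  crossClassPairs : ℕ → ℕ
  crossClassPairs n = ∑ℕ n (λ a → ∑ℕ n (crossBefore a))

  crossBefore-≥ : ∀ a b → b ≤ a → crossBefore a b ≡ 0
  crossBefore-≥ a b b≤a = cong ⟦_⟧ (trans (cong (not (sameClass a b) ∧_) (≤⇒<ᵇ≡false b≤a)) (∧-zeroʳ _))

  crossBefore+sameClass : ∀ a b → a < b → crossBefore a b + ⟦ sameClass a b ⟧ ≡ 1
  crossBefore+sameClass a b a<b =
    trans (cong (λ z → ⟦ z ⟧ + ⟦ sameClass a b ⟧)
                (trans (cong (not (sameClass a b) ∧_) (<⇒<ᵇ≡true a<b)) (∧-identityʳ _)))
          (⟦not⟧+⟦⟧≡1 (sameClass a b))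

  crossClassPairs-suc : ∀ n → crossClassPairs (suc n) ≡ crossClassPairs n + ∑ℕ n (λ a → crossBefore a n)
  crossClassPairs-suc n = begin
    ∑ℕ (suc n) (λ a → ∑ℕ (suc n) (crossBefore a))
      ≡⟨ ∑ℕ-suc n (λ a → ∑ℕ (suc n) (crossBefore a)) ⟩
    ∑ℕ n (λ a → ∑ℕ (suc n) (crossBefore a)) + ∑ℕ (suc n) (crossBefore n)
      ≡⟨ cong₂ _+_ (∑ℕ-cong n (λ a _ → ∑ℕ-suc n (crossBefore a))) last-row ⟩
    ∑ℕ n (λ a → ∑ℕ n (crossBefore a) + crossBefore a n) + 0
      ≡⟨ trans (+-identityʳ _) (∑ℕ-+ n (λ a → ∑ℕ n (crossBefore a)) (λ a → crossBefore a n)) ⟩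
    crossClassPairs n + ∑ℕ n (λ a → crossBefore a n) ∎
    where
    open ≡-Reasoning
    last-row : ∑ℕ (suc n) (crossBefore n) ≡ 0
    last-row = trans (∑ℕ-cong (suc n) (λ b b≤n → crossBefore-≥ n b (s≤s⁻¹ b≤n)))
                     (trans (∑-const (suc n) 0) (*-zeroʳ n))

  crossBefore+classRank : ∀ n → ∑ℕ n (λ a → crossBefore a n) + classRank n ≡ n
  crossBefore+classRank n = begin
    ∑ℕ n (λ a → crossBefore a n) + classRank n
      ≡⟨ sym (∑ℕ-+ n (λ a → crossBefore a n) (λ a → ⟦ sameClass a n ⟧)) ⟩
    ∑ℕ n (λ a → crossBefore a n + ⟦ sameClass a n ⟧)
      ≡⟨ ∑ℕ-cong n (λ a a<n → crossBefore+sameClass a n a<n) ⟩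
    ∑ℕ n (λ _ → 1)
      ≡⟨ trans (∑-const n 1) (*-identityʳ n) ⟩
    n ∎
    where open ≡-Reasoning

  pairs-identity : ∀ n → 2 * crossClassPairs n + 2 * sameClassPairs n + n ≡ n * n
  pairs-identity zero    = refl
  pairs-identity (suc n) = begin
    2 * crossClassPairs (suc n) + 2 * sameClassPairs (suc n) + suc n
      ≡⟨ cong₂ (λ f t → 2 * f + 2 * t + suc n) (crossClassPairs-suc n) (∑ℕ-suc n classRank) ⟩
    2 * (crossClassPairs n + X) + 2 * (sameClassPairs n + classRank n) + suc n
      ≡⟨ regroup (crossClassPairs n) (sameClassPairs n) X (classRank n) n ⟩
    (2 * crossClassPairs n + 2 * sameClassPairs n + n) + 2 * (X + classRank n) + 1
      ≡⟨ cong₂ (λ a b → a + 2 * b + 1) (pairs-identity n) (crossBefore+classRank n) ⟩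
    n * n + 2 * n + 1
      ≡⟨ square-suc n ⟩
    suc n * suc n ∎
    where
    open ≡-Reasoning
    X = ∑ℕ n (λ a → crossBefore a n)
    regroup : ∀ f t x g n → 2 * (f + x) + 2 * (t + g) + suc n ≡ (2 * f + 2 * t + n) + 2 * (x + g) + 1
    regroup = solve-∀
    square-suc : ∀ n → n * n + 2 * n + 1 ≡ suc n * suc n
    square-suc = solve-∀

  turan-identity-q*r+s : ∀ {n} q s → s ≤ r → n ≡ q * r + s →
    2 * turan r n + (2 * q + 1) * n ≡ n * n + r * (q * suc q)
  turan-identity-q*r+s {n} q s s≤r refl = begin
    2 * turan r n + (2 * q + 1) * n
      ≡⟨ cong₂ (λ f t → 2 * f + t) (edgeCountAdj≡∑∑ {n} _) (sym (sameClassPairs-closed q s s≤r)) ⟩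
    2 * crossClassPairs n + (2 * sameClassPairs n + n + r * (q * suc q))
      ≡⟨ sym (+-assoc (2 * crossClassPairs n) _ _) ⟩
    2 * crossClassPairs n + (2 * sameClassPairs n + n) + r * (q * suc q)
      ≡⟨ cong (_+ r * (q * suc q)) (trans (sym (+-assoc (2 * crossClassPairs n) _ n)) (pairs-identity n)) ⟩
    n * n + r * (q * suc q) ∎
    where open ≡-Reasoning

  -- With n = q r + s, the parts have sizes q + 1 (s of them) and q, and 2 t_r(n) = n² − ∑ (part size)².
  turan-identity : ∀ n → let q = n / r in 2 * turan r n + (2 * q + 1) * n ≡ n * n + r * (q * suc q)
  turan-identity n = turan-identity-q*r+s (n / r) (n % r) (<⇒≤ (m%n<n n r))
                       (trans (m≡m%n+[m/n]*n n r) (+-comm (n % r) (n / r * r)))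

-- Sums of squares

n≤n*n : ∀ n → n ≤ n * n
n≤n*n zero    = z≤n
n≤n*n (suc n) = m≤m*n (suc n) (suc n)

2*a*b≤a*a+b*b : ∀ a b → 2 * a * b ≤ a * a + b * b
2*a*b≤a*a+b*b a b =
  [ ordered , (λ b≤a → subst₂ _≤_ (swap b a) (+-comm (b * b) (a * a)) (ordered b≤a)) ]′ (≤-total a b)
  where
  swap : ∀ a b → 2 * a * b ≡ 2 * b * a
  swap = solve-∀
  expand : ∀ a d → 2 * a * (a + d) + d * d ≡ a * a + (a + d) * (a + d)
  expand = solve-∀
  ordered : ∀ {a b} → a ≤ b → 2 * a * b ≤ a * a + b * b
  ordered {a} a≤b with d , refl ← m≤n⇒∃[o]m+o≡n a≤b = ≤-trans (m≤m+n _ (d * d)) (≤-reflexive (expand a d))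

2*a*t+t≤t*t+a*a+a : ∀ {a t} → a ≤ t → 2 * a * t + t ≤ t * t + a * a + a
2*a*t+t≤t*t+a*a+a {a} a≤t with d , refl ← m≤n⇒∃[o]m+o≡n a≤t =
  subst₂ _≤_ (sym (expandˡ a d)) (sym (expandʳ a d)) (+-monoʳ-≤ (2 * a * a + 2 * a * d + a) (n≤n*n d))
  where
  expandˡ : ∀ a d → 2 * a * (a + d) + (a + d) ≡ (2 * a * a + 2 * a * d + a) + d
  expandˡ = solve-∀
  expandʳ : ∀ a d → (a + d) * (a + d) + a * a + a ≡ (2 * a * a + 2 * a * d + a) + d * d
  expandʳ = solve-∀

-- (a − q)(a − q − 1) ≥ 0 for integers a, q.
[2q+1]*a≤a*a+q*[1+q] : ∀ q a → (2 * q + 1) * a ≤ a * a + q * suc q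
[2q+1]*a≤a*a+q*[1+q] q a with ≤-<-connex a q
... | inj₁ a≤q with d , refl ← m≤n⇒∃[o]m+o≡n a≤q = ≤-trans (m≤m+n _ (d * d + d)) (≤-reflexive (below a d))
  where
  below : ∀ a d → (2 * (a + d) + 1) * a + (d * d + d) ≡ a * a + (a + d) * suc (a + d)
  below = solve-∀
... | inj₂ q<a with d , refl ← m≤n⇒∃[o]m+o≡n q<a = ≤-trans (m≤m+n _ (d * d + d)) (≤-reflexive (above q d))
  where
  above : ∀ q d → (2 * q + 1) * (suc q + d) + (d * d + d) ≡ (suc q + d) * (suc q + d) + q * suc q
  above = solve-∀

sumSq : List ℕ → ℕ
sumSq l = sum (map (λ a → a * a) l)

sum-∷ʳ : ∀ l x → sum (l ++ [ x ]) ≡ sum l + x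
sum-∷ʳ l x = trans (sum-++ l [ x ]) (cong (sum l +_) (+-identityʳ x))

sumSq-∷ʳ : ∀ l x → sumSq (l ++ [ x ]) ≡ sumSq l + x * x
sumSq-∷ʳ l x = trans (cong sum (map-++ _ l [ x ])) (sum-∷ʳ (map _ l) (x * x))

sum≤length*x : ∀ {x} {l : List ℕ} → All (_≤ x) l → sum l ≤ length l * x
sum≤length*x []           = z≤n
sum≤length*x (a≤x ∷ l≤x) = +-mono-≤ a≤x (sum≤length*x l≤x)

2*x*sum≤length*[x*x]+sumSq : ∀ x l → 2 * x * sum l ≤ length l * (x * x) + sumSq l
2*x*sum≤length*[x*x]+sumSq x []      = ≤-reflexive (*-zeroʳ (2 * x))
2*x*sum≤length*[x*x]+sumSq x (a ∷ l) = begin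
  2 * x * (a + sum l)                                   ≡⟨ *-distribˡ-+ (2 * x) a (sum l) ⟩
  2 * x * a + 2 * x * sum l                             ≤⟨ +-mono-≤ (2*a*b≤a*a+b*b x a) (2*x*sum≤length*[x*x]+sumSq x l) ⟩
  (x * x + a * a) + (length l * (x * x) + sumSq l)      ≡⟨ regroup (x * x) (a * a) (length l) (sumSq l) ⟩
  suc (length l) * (x * x) + (a * a + sumSq l)          ∎
  where
  open ≤-Reasoning
  regroup : ∀ y b k s → (y + b) + (k * y + s) ≡ suc k * y + (b + s)
  regroup = solve-∀

sum*sum≤length*sumSq : ∀ l → sum l * sum l ≤ length l * sumSq l
sum*sum≤length*sumSq []      = z≤n
sum*sum≤length*sumSq (a ∷ l) = begin
  (a + sum l) * (a + sum l)                                      ≡⟨ expand a (sum l) ⟩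
  a * a + 2 * a * sum l + sum l * sum l
    ≤⟨ +-mono-≤ (+-monoʳ-≤ (a * a) (2*x*sum≤length*[x*x]+sumSq a l)) (sum*sum≤length*sumSq l) ⟩
  a * a + (length l * (a * a) + sumSq l) + length l * sumSq l     ≡⟨ collect (a * a) (sumSq l) (length l) ⟩
  suc (length l) * (a * a + sumSq l)                             ∎
  where
  open ≤-Reasoning
  expand : ∀ a s → (a + s) * (a + s) ≡ a * a + 2 * a * s + s * s
  expand = solve-∀
  collect : ∀ b s k → b + (k * b + s) + k * s ≡ suc k * (b + s)
  collect = solve-∀

2*a*sum+sum≤sumSq+length*[a*a+a] : ∀ {a} {l : List ℕ} → All (a ≤_) l →
  2 * a * sum l + sum l ≤ sumSq l + length l * (a * a + a)
2*a*sum+sum≤sumSq+length*[a*a+a] {a} []                  = ≤-reflexive (cong (_+ 0) (*-zeroʳ (2 * a)))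
2*a*sum+sum≤sumSq+length*[a*a+a] {a} {t ∷ l} (a≤t ∷ a≤l) = begin
  2 * a * (t + sum l) + (t + sum l)                          ≡⟨ regroup a t (sum l) ⟩
  (2 * a * t + t) + (2 * a * sum l + sum l)
    ≤⟨ +-mono-≤ (2*a*t+t≤t*t+a*a+a a≤t) (2*a*sum+sum≤sumSq+length*[a*a+a] a≤l) ⟩
  (t * t + a * a + a) + (sumSq l + length l * (a * a + a))   ≡⟨ collect (t * t) a (sumSq l) (length l) ⟩
  t * t + sumSq l + suc (length l) * (a * a + a)             ∎
  where
  open ≤-Reasoning
  regroup : ∀ a t s → 2 * a * (t + s) + (t + s) ≡ (2 * a * t + t) + (2 * a * s + s)
  regroup = solve-∀
  collect : ∀ u a s k → (u + a * a + a) + (s + k * (a * a + a)) ≡ u + s + suc k * (a * a + a)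
  collect = solve-∀

-- For k = length, S = sum and Q = sumSq: k Q − S² = ∑_{i<j} (a_i − a_j)² ≥ ∑_j (a_j − a) = S − k a,
-- as the entries are integers ≥ a.
sum*sum+sum≤length*sumSq+length*head : ∀ a t → All (a ≤_) t →
  sum (a ∷ t) * sum (a ∷ t) + sum (a ∷ t) ≤ length (a ∷ t) * sumSq (a ∷ t) + length (a ∷ t) * a
sum*sum+sum≤length*sumSq+length*head a t a≤t = begin
  (a + S) * (a + S) + (a + S)                     ≡⟨ expand a S ⟩
  S * S + (2 * a * S + S) + (a * a + a)
    ≤⟨ +-monoˡ-≤ (a * a + a) (+-mono-≤ (sum*sum≤length*sumSq t) (2*a*sum+sum≤sumSq+length*[a*a+a] a≤t)) ⟩
  k * Q + (Q + k * (a * a + a)) + (a * a + a)     ≡⟨ collect a Q k ⟩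
  suc k * (a * a + Q) + suc k * a                 ∎
  where
  open ≤-Reasoning
  S = sum t
  Q = sumSq t
  k = length t
  expand : ∀ a S → (a + S) * (a + S) + (a + S) ≡ S * S + (2 * a * S + S) + (a * a + a)
  expand = solve-∀
  collect : ∀ a Q k → k * Q + (Q + k * (a * a + a)) + (a * a + a) ≡ suc k * (a * a + Q) + suc k * a
  collect = solve-∀

[2q+1]*sum≤sumSq+length*q*[1+q] : ∀ q l → (2 * q + 1) * sum l ≤ sumSq l + length l * (q * suc q)
[2q+1]*sum≤sumSq+length*q*[1+q] q []      = ≤-reflexive (*-zeroʳ (2 * q + 1))
[2q+1]*sum≤sumSq+length*q*[1+q] q (a ∷ l) = begin
  (2 * q + 1) * (a + sum l)                                    ≡⟨ *-distribˡ-+ (2 * q + 1) a (sum l) ⟩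
  (2 * q + 1) * a + (2 * q + 1) * sum l
    ≤⟨ +-mono-≤ ([2q+1]*a≤a*a+q*[1+q] q a) ([2q+1]*sum≤sumSq+length*q*[1+q] q l) ⟩
  (a * a + q * suc q) + (sumSq l + length l * (q * suc q))     ≡⟨ collect (a * a) (sumSq l) (length l) (q * suc q) ⟩
  a * a + sumSq l + suc (length l) * (q * suc q)               ∎
  where
  open ≤-Reasoning
  collect : ∀ b s k c → (b + c) + (s + k * c) ≡ b + s + suc k * c
  collect = solve-∀

deficit : ℕ → List ℕ → ℕ
deficit x l = sum (map (λ c → c * (x ∸ c)) l)

deficit-∷ʳ : ∀ {x} l c → deficit x (l ++ [ c ]) ≡ deficit x l + c * (x ∸ c)
deficit-∷ʳ {x} l c = trans (cong sum (map-++ _ l [ c ])) (sum-∷ʳ (map _ l) (c * (x ∸ c)))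

deficit+sumSq≡x*sum : ∀ {x} {l : List ℕ} → All (_≤ x) l → deficit x l + sumSq l ≡ x * sum l
deficit+sumSq≡x*sum {x} []                  = sym (*-zeroʳ x)
deficit+sumSq≡x*sum {x} {c ∷ l} (c≤x ∷ l≤x) = begin
  (c * (x ∸ c) + W) + (c * c + sumSq l)     ≡⟨ regroup (c * (x ∸ c)) W (c * c) (sumSq l) ⟩
  (c * (x ∸ c) + c * c) + (W + sumSq l)     ≡⟨ cong₂ _+_ single (deficit+sumSq≡x*sum l≤x) ⟩
  x * c + x * sum l                         ≡⟨ sym (*-distribˡ-+ x c (sum l)) ⟩
  x * (c + sum l)                           ∎
  where
  open ≡-Reasoning
  W = deficit x l
  regroup : ∀ p w s q → (p + w) + (s + q) ≡ (p + s) + (w + q)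
  regroup = solve-∀
  single : c * (x ∸ c) + c * c ≡ x * c
  single = trans (sym (*-distribˡ-+ c (x ∸ c) c)) (trans (cong (c *_) (m∸n+n≡m c≤x)) (*-comm c x))

-- Prefix sums of codegrees

n*x+sumSq≤N+x*sum-∷ʳ : ∀ {n N x} l → n * x + sumSq l ≤ N + x * sum l →
  n * x + sumSq (l ++ [ x ]) ≤ N + x * sum (l ++ [ x ])
n*x+sumSq≤N+x*sum-∷ʳ {n} {N} {x} l bound = begin
  n * x + sumSq (l ++ [ x ])      ≡⟨ cong (n * x +_) (sumSq-∷ʳ l x) ⟩
  n * x + (sumSq l + x * x)       ≡⟨ sym (+-assoc (n * x) _ _) ⟩
  n * x + sumSq l + x * x         ≤⟨ +-monoˡ-≤ (x * x) bound ⟩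
  N + x * sum l + x * x           ≡⟨ +-assoc N _ _ ⟩
  N + (x * sum l + x * x)         ≡⟨ cong (N +_) (sym (*-distribˡ-+ x (sum l) x)) ⟩
  N + x * (sum l + x)             ≡⟨ cong (λ s → N + x * s) (sym (sum-∷ʳ l x)) ⟩
  N + x * sum (l ++ [ x ])        ∎
  where open ≤-Reasoning

n*x+Q≤N+x*S⇒[n∸S]*x+Q≤N : ∀ {n S x Q N} → S ≤ n → n * x + Q ≤ N + x * S → (n ∸ S) * x + Q ≤ N
n*x+Q≤N+x*S⇒[n∸S]*x+Q≤N {n} {S} {x} {Q} {N} S≤n le = +-cancelʳ-≤ (x * S) _ _ (begin
  (n ∸ S) * x + Q + x * S   ≡⟨ regroup (n ∸ S) S x Q ⟩
  (S + (n ∸ S)) * x + Q     ≡⟨ cong (λ m → m * x + Q) (m+[n∸m]≡n S≤n) ⟩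
  n * x + Q                 ≤⟨ le ⟩
  N + x * S                 ∎)
  where
  open ≤-Reasoning
  regroup : ∀ z S x Q → z * x + Q + x * S ≡ (S + z) * x + Q
  regroup = solve-∀

y*x+r*c≤y*y+m*c⇒y≡x×m≡r : ∀ {x y m r c} → 1 ≤ y → 1 ≤ c → y ≤ x → m ≤ r →
  y * x + r * c ≤ y * y + m * c → y ≡ x × m ≡ r
y*x+r*c≤y*y+m*c⇒y≡x×m≡r {x} {y@(suc _)} {m} {r} {c@(suc _)} _ _ y≤x m≤r le = y≡x , m≡r
  where
  m≡r : m ≡ r
  m≡r = ≤-antisym m≤r
          (*-cancelʳ-≤ r m c (+-cancelˡ-≤ (y * y) _ _ (≤-trans (+-monoˡ-≤ (r * c) (*-monoʳ-≤ y y≤x)) le)))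
  y≡x : y ≡ x
  y≡x = ≤-antisym y≤x
          (*-cancelˡ-≤ y (+-cancelʳ-≤ (r * c) _ _ (subst (λ m → y * x + r * c ≤ y * y + m * c) m≡r le)))

-- With y = n ∸ sum l the bound reads y x + sumSq l ≤ N; measured against the Turán bound through
-- [2q+1]*sum≤sumSq+length*q*[1+q] for y ∷ l, it leaves no room for y < x or length l + 1 < r.
prefix-step : ∀ {n N r q x} (l : List ℕ) → 1 ≤ q → N + r * (q * suc q) ≤ (2 * q + 1) * n →
  length l < r → sum l < n → n * x + sumSq l ≤ N + x * sum l →
  sum l + x < n ⊎ (sum l + x ≡ n × suc (length l) ≡ r)
prefix-step {n} {N} {r} {q} {x} l 1≤q turán l<r S<n key with sum l + x <? n
... | yes S+x<n = inj₁ S+x<n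
... | no  S+x≮n = inj₂ (S+x≡n , proj₂ tight)
  where
  open ≤-Reasoning
  S = sum l
  Q = sumSq l
  c = q * suc q
  y = n ∸ S
  y+S≡n : y + S ≡ n
  y+S≡n = trans (+-comm y S) (m+[n∸m]≡n (<⇒≤ S<n))
  swap : ∀ a b c → a + b + c ≡ a + c + b
  swap = solve-∀
  bound : y * x + r * c ≤ y * y + suc (length l) * c
  bound = +-cancelʳ-≤ Q _ _ (begin
    y * x + r * c + Q                 ≡⟨ swap (y * x) (r * c) Q ⟩
    y * x + Q + r * c                 ≤⟨ +-monoˡ-≤ (r * c) (n*x+Q≤N+x*S⇒[n∸S]*x+Q≤N (<⇒≤ S<n) key) ⟩
    N + r * c                         ≤⟨ turán ⟩
    (2 * q + 1) * n                   ≡⟨ cong ((2 * q + 1) *_) (sym y+S≡n) ⟩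
    (2 * q + 1) * (y + S)             ≤⟨ [2q+1]*sum≤sumSq+length*q*[1+q] q (y ∷ l) ⟩
    y * y + Q + suc (length l) * c    ≡⟨ swap (y * y) Q _ ⟩
    y * y + suc (length l) * c + Q    ∎)
  tight : y ≡ x × suc (length l) ≡ r
  tight = y*x+r*c≤y*y+m*c⇒y≡x×m≡r (m<n⇒0<n∸m S<n) (*-mono-≤ 1≤q (s≤s z≤n))
            (m≤n+o⇒m∸n≤o n S (≮⇒≥ S+x≮n)) l<r bound
  S+x≡n : S + x ≡ n
  S+x≡n = trans (cong (S +_) (sym (proj₁ tight))) (m+[n∸m]≡n (<⇒≤ S<n))

n*S<k*N : ∀ {n N k S a} .{{_ : NonZero k}} → n * S + S ≤ k * N + k * a → n * a < N → n * S < k * N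
n*S<k*N {n} {N} {k} {S} {a} le n*a<N with n * S <? k * N
... | yes n*S<k*N = n*S<k*N
... | no  n*S≮k*N = contradiction (begin-strict
  n * S         ≤⟨ *-monoʳ-≤ n S≤k*a ⟩
  n * (k * a)   ≡⟨ swap n k a ⟩
  k * (n * a)   <⟨ *-monoʳ-< k n*a<N ⟩
  k * N         ∎) n*S≮k*N
  where
  open ≤-Reasoning
  swap : ∀ n k a → n * (k * a) ≡ k * (n * a)
  swap = solve-∀
  S≤k*a : S ≤ k * a
  S≤k*a = +-cancelˡ-≤ (n * S) _ _ (≤-trans le (+-monoˡ-≤ (k * a) (≮⇒≥ n*S≮k*N)))

n*sum<length*N : ∀ {n N x} a t → All (a ≤_) t → All (_≤ x) (a ∷ t) → sum (a ∷ t) ≤ n →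
  n * x + sumSq (a ∷ t) ≤ N + x * sum (a ∷ t) → n * a < N → n * sum (a ∷ t) < length (a ∷ t) * N
n*sum<length*N {n} {N} {x} a t a≤t l≤x S≤n key n*a<N = n*S<k*N {n} {N} {k} (begin
  n * S + S                       ≡⟨ cong (λ m → m * S + S) (sym (m+[n∸m]≡n S≤n)) ⟩
  (S + z) * S + S                 ≡⟨ regroup S z ⟩
  z * S + (S * S + S)
    ≤⟨ +-mono-≤ (*-monoʳ-≤ z (sum≤length*x l≤x)) (sum*sum+sum≤length*sumSq+length*head a t a≤t) ⟩
  z * (k * x) + (k * Q + k * a)   ≡⟨ collect z k x Q a ⟩
  k * (z * x + Q) + k * a         ≤⟨ +-monoˡ-≤ (k * a) (*-monoʳ-≤ k (n*x+Q≤N+x*S⇒[n∸S]*x+Q≤N S≤n key)) ⟩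
  k * N + k * a                   ∎) n*a<N
  where
  open ≤-Reasoning
  S = sum (a ∷ t)
  Q = sumSq (a ∷ t)
  k = length (a ∷ t)
  z = n ∸ S
  regroup : ∀ S z → (S + z) * S + S ≡ z * S + (S * S + S)
  regroup = solve-∀
  collect : ∀ z k x Q a → z * (k * x) + (k * Q + k * a) ≡ k * (z * x + Q) + k * a
  collect = solve-∀

2*r*m<n*D : ∀ {n r m C E D} → n * E < r * C → C + (m + m) ≡ n * n → E + D ≡ r * n → 2 * r * m < n * D
2*r*m<n*D {n} {r} {m} {C} {E} {D} n*E<r*C C+2m≡n*n E+D≡r*n = +-cancelˡ-< (n * E) _ _ (begin-strict
  n * E + 2 * r * m   <⟨ +-monoˡ-< (2 * r * m) n*E<r*C ⟩
  r * C + 2 * r * m   ≡⟨ factor r C m ⟩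
  r * (C + (m + m))   ≡⟨ cong (r *_) C+2m≡n*n ⟩
  r * (n * n)         ≡⟨ swap r n ⟩
  n * (r * n)         ≡⟨ cong (n *_) (sym E+D≡r*n) ⟩
  n * (E + D)         ≡⟨ *-distribˡ-+ n E D ⟩
  n * E + n * D       ∎)
  where
  open ≤-Reasoning
  factor : ∀ r C m → r * C + 2 * r * m ≡ r * (C + (m + m))
  factor = solve-∀
  swap : ∀ r n → r * (n * n) ≡ n * (r * n)
  swap = solve-∀

-- Degrees, codegrees and greedy sequences

module _ {n : ℕ} (G : Graph n) where

  deg≡∑ : ∀ u → deg G u ≡ ∑[ v < n ] ⟦ adj G u v ⟧
  deg≡∑ u = sum-map-allFin n _

  private
    ordered : Fin n → Fin n → ℕ
    ordered u v = ⟦ adj G u v ∧ (toℕ u <ᵇ toℕ v) ⟧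

    adj≡ordered+ordered : ∀ u v → ⟦ adj G u v ⟧ ≡ ordered u v + ordered v u
    adj≡ordered+ordered u v with <-cmpᶠ u v
    ... | tri< u<v _ _
      rewrite <⇒<ᵇ≡true u<v | ≤⇒<ᵇ≡false (<⇒≤ u<v) | ∧-identityʳ (adj G u v) | ∧-zeroʳ (adj G v u) =
      sym (+-identityʳ _)
    ... | tri> _ _ v<u
      rewrite <⇒<ᵇ≡true v<u | ≤⇒<ᵇ≡false (<⇒≤ v<u) | ∧-identityʳ (adj G v u) | ∧-zeroʳ (adj G u v) =
      cong ⟦_⟧ (Graph.sym G u v)
    ... | tri≈ _ refl _ rewrite irrefl G u = refl

  handshake : ∑ (deg G) ≡ edges G + edges G
  handshake = begin
    ∑[ u < n ] deg G u
      ≡⟨ sum-cong-≗ {n} deg≡∑ ⟩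
    ∑[ u < n ] ∑[ v < n ] ⟦ adj G u v ⟧
      ≡⟨ sum-cong-≗ {n} (λ u → trans (sum-cong-≗ {n} (adj≡ordered+ordered u))
                                     (∑-distrib-+ {n} (ordered u) (λ v → ordered v u))) ⟩
    ∑[ u < n ] (∑[ v < n ] ordered u v + ∑[ v < n ] ordered v u)
      ≡⟨ ∑-distrib-+ {n} (λ u → ∑[ v < n ] ordered u v) (λ u → ∑[ v < n ] ordered v u) ⟩
    ∑[ u < n ] ∑[ v < n ] ordered u v + ∑[ u < n ] ∑[ v < n ] ordered v u
      ≡⟨ cong (∑[ u < n ] ∑[ v < n ] ordered u v +_) (∑-comm {n} {n} (λ u v → ordered v u)) ⟩
    ∑[ u < n ] ∑[ v < n ] ordered u v + ∑[ v < n ] ∑[ u < n ] ordered v u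
      ≡⟨ sym (cong₂ _+_ (edgeCountAdj≡∑∑ (adj G)) (edgeCountAdj≡∑∑ (adj G))) ⟩
    edges G + edges G ∎
    where open ≡-Reasoning

  deg<n : ∀ u → deg G u < n
  deg<n u = begin-strict
    deg G u                    ≡⟨ deg≡∑ u ⟩
    ∑[ v < n ] ⟦ adj G u v ⟧   <⟨ ∑-mono-< (λ v → ⟦⟧≤1 (adj G u v)) u (subst (λ b → ⟦ b ⟧ < 1) (sym (irrefl G u)) z<s) ⟩
    ∑[ v < n ] 1               ≡⟨ trans (∑-const n 1) (*-identityʳ n) ⟩
    n                          ∎
    where open ≤-Reasoning

  -- the number of vertices not adjacent to u, u itself included
  codeg : Fin n → ℕ
  codeg u = n ∸ deg G u

  codegs : List (Fin n) → List ℕ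
  codegs = map codeg

  codegSum : ℕ
  codegSum = ∑ codeg

  length-codegs : ∀ vs → length (codegs vs) ≡ length vs
  length-codegs = length-map codeg

  all-codegs : ∀ {P : ℕ → Set} → (∀ u → P (codeg u)) → ∀ vs → All P (codegs vs)
  all-codegs P-codeg vs = map⁺ (All.tabulate (λ {u} _ → P-codeg u))

  codeg+deg≡n : ∀ u → codeg u + deg G u ≡ n
  codeg+deg≡n u = m∸n+n≡m (<⇒≤ (deg<n u))

  codegSum+2*edges≡n*n : codegSum + (edges G + edges G) ≡ n * n
  codegSum+2*edges≡n*n = begin
    codegSum + (edges G + edges G)   ≡⟨ cong (codegSum +_) (sym handshake) ⟩
    codegSum + ∑ (deg G)             ≡⟨ sym (∑-distrib-+ {n} codeg (deg G)) ⟩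
    ∑[ u < n ] (codeg u + deg G u)   ≡⟨ sum-cong-≗ {n} codeg+deg≡n ⟩
    ∑[ u < n ] n                     ≡⟨ ∑-const n n ⟩
    n * n                            ∎
    where open ≡-Reasoning

  1≤codeg : ∀ u → 1 ≤ codeg u
  1≤codeg u = m<n⇒0<n∸m (deg<n u)

  codeg-antitone : ∀ {u v} → deg G u ≤ deg G v → codeg v ≤ codeg u
  codeg-antitone = ∸-monoʳ-≤ n

  ∑-nonadjacent≡codeg : ∀ v → ∑[ u < n ] ⟦ not (adj G v u) ⟧ ≡ codeg v
  ∑-nonadjacent≡codeg v = begin
    nonadj                      ≡⟨ sym (m+n∸n≡m nonadj (deg G v)) ⟩
    nonadj + deg G v ∸ deg G v  ≡⟨ cong (λ d → nonadj + d ∸ deg G v) (deg≡∑ v) ⟩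
    nonadj + ∑[ u < n ] ⟦ adj G v u ⟧ ∸ deg G v
      ≡⟨ cong (_∸ deg G v) (sym (∑-distrib-+ {n} (λ u → ⟦ not (adj G v u) ⟧) (λ u → ⟦ adj G v u ⟧))) ⟩
    ∑[ u < n ] (⟦ not (adj G v u) ⟧ + ⟦ adj G v u ⟧) ∸ deg G v
      ≡⟨ cong (_∸ deg G v) (trans (sum-cong-≗ {n} (⟦not⟧+⟦⟧≡1 ∘ adj G v))
                                  (trans (∑-const n 1) (*-identityʳ n))) ⟩
    codeg v                     ∎
    where
    open ≡-Reasoning
    nonadj = ∑[ u < n ] ⟦ not (adj G v u) ⟧

  sum-codegs+sum-degs : ∀ vs → sum (codegs vs) + sum (map (deg G) vs) ≡ length vs * n
  sum-codegs+sum-degs []       = refl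
  sum-codegs+sum-degs (v ∷ vs) = begin
    (codeg v + sum (codegs vs)) + (deg G v + sum (map (deg G) vs))
      ≡⟨ regroup (codeg v) (sum (codegs vs)) (deg G v) _ ⟩
    (codeg v + deg G v) + (sum (codegs vs) + sum (map (deg G) vs))
      ≡⟨ cong₂ _+_ (codeg+deg≡n v) (sum-codegs+sum-degs vs) ⟩
    n + length vs * n ∎
    where
    open ≡-Reasoning
    regroup : ∀ a b c d → (a + b) + (c + d) ≡ (a + c) + (b + d)
    regroup = solve-∀

  codegSum+r*q[1+q]≤[2q+1]*n : ∀ {r q} → turan r n ≤ edges G →
    2 * turan r n + (2 * q + 1) * n ≡ n * n + r * (q * suc q) → codegSum + r * (q * suc q) ≤ (2 * q + 1) * n
  codegSum+r*q[1+q]≤[2q+1]*n {r} {q} t≤m turán-identity = +-cancelˡ-≤ (2 * turan r n) _ _ (begin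
    2 * turan r n + (codegSum + R)       ≤⟨ +-monoˡ-≤ _ (*-monoʳ-≤ 2 t≤m) ⟩
    2 * edges G + (codegSum + R)         ≡⟨ regroup (edges G) codegSum R ⟩
    codegSum + (edges G + edges G) + R   ≡⟨ cong (_+ R) codegSum+2*edges≡n*n ⟩
    n * n + R                            ≡⟨ sym turán-identity ⟩
    2 * turan r n + (2 * q + 1) * n      ∎)
    where
    open ≤-Reasoning
    R = r * (q * suc q)
    regroup : ∀ m C R → 2 * m + (C + R) ≡ C + (m + m) + R
    regroup = solve-∀

  n*codeg<codegSum : ∀ {a} → (∀ w → deg G w ≤ deg G a) → ¬ Regular G → n * codeg a < codegSum
  n*codeg<codegSum {a} a-max irregular
    with u , deg-u≢deg-a ← ¬∀⟶∃¬ n (λ u → deg G u ≡ deg G a) (λ u → deg G u ≟ deg G a)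
                                   (λ all → irregular (λ u w → trans (all u) (sym (all w)))) =
    subst (_< codegSum) (∑-const n (codeg a))
      (∑-mono-< (λ w → codeg-antitone (a-max w)) u
                (∸-monoʳ-< (≤∧≢⇒< (a-max u) deg-u≢deg-a) (<⇒≤ (deg<n a))))

  Γ̂? : ∀ pre u → Dec (InCommonNbr G pre u)
  Γ̂? pre u = all? (λ p → adj G p u ≟ᴮ true) pre

  ∣Γ̂_∣ : List (Fin n) → ℕ
  ∣Γ̂ pre ∣ = ∑[ u < n ] ⟦ does (Γ̂? pre u) ⟧

  ∣Γ̂∣-∷ʳ : ∀ {pre v} → InCommonNbr G pre v → ∣Γ̂ pre ++ [ v ] ∣ < ∣Γ̂ pre ∣
  ∣Γ̂∣-∷ʳ {pre} {v} v∈Γ̂ = ∑-mono-< shrinks v v-leaves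
    where
    shrinks : ∀ u → ⟦ does (Γ̂? (pre ++ [ v ]) u) ⟧ ≤ ⟦ does (Γ̂? pre u) ⟧
    shrinks u with Γ̂? (pre ++ [ v ]) u | Γ̂? pre u
    ... | yes _        | yes _    = ≤-refl
    ... | yes u∈Γ̂⁺   | no  u∉Γ̂ = contradiction (++⁻ˡ pre u∈Γ̂⁺) u∉Γ̂
    ... | no  _        | _        = z≤n
    v-leaves : ⟦ does (Γ̂? (pre ++ [ v ]) v) ⟧ < ⟦ does (Γ̂? pre v) ⟧
    v-leaves with Γ̂? (pre ++ [ v ]) v | Γ̂? pre v
    ... | yes v∈Γ̂⁺ | _        with () ← trans (sym (irrefl G v)) (All.head (++⁻ʳ pre v∈Γ̂⁺))
    ... | no  _     | yes _    = z<s
    ... | no  _     | no  v∉Γ̂ = contradiction v∈Γ̂ v∉Γ̂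

  greedy-from : ∀ pre fuel → ∣Γ̂ pre ∣ ≤ fuel → Σ (List (Fin n)) (Greedy G pre)
  greedy-from pre fuel bound with empty-or-argmax (InCommonNbr G pre) (Γ̂? pre) (deg G)
  ... | inj₁ empty = [] , empty
  greedy-from pre zero       bound | inj₂ (v , v∈Γ̂ , _) =
    contradiction (<-≤-trans (∣Γ̂∣-∷ʳ v∈Γ̂) bound) n≮0
  greedy-from pre (suc fuel) bound | inj₂ (v , v∈Γ̂ , v-max)
    with rest , greedy ← greedy-from (pre ++ [ v ]) fuel (s≤s⁻¹ (<-≤-trans (∣Γ̂∣-∷ʳ v∈Γ̂) bound)) =
    v ∷ rest , v∈Γ̂ , v-max , greedy

  pSeq-exists : Σ (List (Fin n)) (PSeq G)
  pSeq-exists = greedy-from [] n (≤-reflexive (trans (∑-const n 1) (*-identityʳ n)))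

  outside : List (Fin n) → Fin n → ℕ
  outside pre u = ⟦ not (does (Γ̂? pre u)) ⟧

  -- Each u outside Γ̂(pre) is charged to the first p ∈ pre it is not adjacent to: u was a candidate
  -- when p was chosen, so codeg p ≤ codeg u, and p has codeg p non-neighbours.
  record GreedyPrefix (pre : List (Fin n)) : Set where
    field
      outside-bound : ∀ x → ∑[ u < n ] (outside pre u * (x ∸ codeg u)) ≤ deficit x (codegs pre)
      dominated     : ∀ w → InCommonNbr G pre w → All (λ p → deg G w ≤ deg G p) pre

  greedyPrefix-[] : GreedyPrefix []
  greedyPrefix-[] = record
    { outside-bound = λ _ → ≤-reflexive (trans (∑-const n 0) (*-zeroʳ n))
    ; dominated     = λ _ _ → []
    }

  greedyPrefix-∷ʳ : ∀ {pre v} → GreedyPrefix pre → (∀ w → InCommonNbr G pre w → deg G w ≤ deg G v) →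
    GreedyPrefix (pre ++ [ v ])
  greedyPrefix-∷ʳ {pre} {v} inv v-max = record { outside-bound = outside-bound′ ; dominated = dominated′ }
    where
    open GreedyPrefix inv
    charge : ∀ x u → outside (pre ++ [ v ]) u * (x ∸ codeg u)
                   ≤ outside pre u * (x ∸ codeg u) + ⟦ not (adj G v u) ⟧ * (x ∸ codeg v)
    charge x u with Γ̂? (pre ++ [ v ]) u | Γ̂? pre u
    ... | yes _ | _     = z≤n
    ... | no  _ | no  _ = m≤m+n _ _
    ... | no  u∉Γ̂⁺ | yes u∈Γ̂ with adj G v u in v~u
    ...   | true  = contradiction (++⁺ u∈Γ̂ (v~u ∷ [])) u∉Γ̂⁺
    ...   | false = +-monoˡ-≤ _ (∸-monoʳ-≤ x (codeg-antitone (v-max u u∈Γ̂)))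
    outside-bound′ : ∀ x → ∑[ u < n ] (outside (pre ++ [ v ]) u * (x ∸ codeg u))
                         ≤ deficit x (codegs (pre ++ [ v ]))
    outside-bound′ x = begin
      ∑[ u < n ] (outside (pre ++ [ v ]) u * (x ∸ codeg u))
        ≤⟨ ∑-mono-≤ (charge x) ⟩
      ∑[ u < n ] (outside pre u * (x ∸ codeg u) + ⟦ not (adj G v u) ⟧ * (x ∸ codeg v))
        ≡⟨ ∑-distrib-+ {n} _ _ ⟩
      ∑[ u < n ] (outside pre u * (x ∸ codeg u)) + ∑[ u < n ] (⟦ not (adj G v u) ⟧ * (x ∸ codeg v))
        ≤⟨ +-monoˡ-≤ _ (outside-bound x) ⟩
      deficit x (codegs pre) + ∑[ u < n ] (⟦ not (adj G v u) ⟧ * (x ∸ codeg v))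
        ≡⟨ cong (deficit x (codegs pre) +_) nonadjacent-charge ⟩
      deficit x (codegs pre) + codeg v * (x ∸ codeg v)
        ≡⟨ sym (trans (cong (deficit x) (map-++ codeg pre [ v ])) (deficit-∷ʳ (codegs pre) (codeg v))) ⟩
      deficit x (codegs (pre ++ [ v ])) ∎
      where
      open ≤-Reasoning
      nonadjacent-charge : ∑[ u < n ] (⟦ not (adj G v u) ⟧ * (x ∸ codeg v)) ≡ codeg v * (x ∸ codeg v)
      nonadjacent-charge = trans (sym (*-distribʳ-sum (x ∸ codeg v) (λ u → ⟦ not (adj G v u) ⟧)))
                                 (cong (_* (x ∸ codeg v)) (∑-nonadjacent≡codeg v))
    dominated′ : ∀ w → InCommonNbr G (pre ++ [ v ]) w → All (λ p → deg G w ≤ deg G p) (pre ++ [ v ])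
    dominated′ w w∈Γ̂⁺ = ++⁺ (dominated w (++⁻ˡ pre w∈Γ̂⁺)) (v-max w (++⁻ˡ pre w∈Γ̂⁺) ∷ [])

  n*x+sumSq≤codegSum+x*sum : ∀ {pre x} → GreedyPrefix pre → (∀ u → InCommonNbr G pre u → x ≤ codeg u) →
    All (_≤ x) (codegs pre) → n * x + sumSq (codegs pre) ≤ codegSum + x * sum (codegs pre)
  n*x+sumSq≤codegSum+x*sum {pre} {x} inv x≤Γ̂ pre≤x = begin
    n * x + sumSq (codegs pre)
      ≡⟨ cong (_+ sumSq (codegs pre)) (sym (∑-const n x)) ⟩
    ∑[ u < n ] x + sumSq (codegs pre)
      ≤⟨ +-monoˡ-≤ _ (∑-mono-≤ split) ⟩
    ∑[ u < n ] (codeg u + outside pre u * (x ∸ codeg u)) + sumSq (codegs pre)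
      ≡⟨ cong (_+ sumSq (codegs pre)) (∑-distrib-+ {n} codeg _) ⟩
    codegSum + ∑[ u < n ] (outside pre u * (x ∸ codeg u)) + sumSq (codegs pre)
      ≤⟨ +-monoˡ-≤ _ (+-monoʳ-≤ codegSum (outside-bound x)) ⟩
    codegSum + deficit x (codegs pre) + sumSq (codegs pre)
      ≡⟨ +-assoc codegSum _ _ ⟩
    codegSum + (deficit x (codegs pre) + sumSq (codegs pre))
      ≡⟨ cong (codegSum +_) (deficit+sumSq≡x*sum pre≤x) ⟩
    codegSum + x * sum (codegs pre) ∎
    where
    open ≤-Reasoning
    open GreedyPrefix inv
    split : ∀ u → x ≤ codeg u + outside pre u * (x ∸ codeg u)
    split u with Γ̂? pre u
    ... | yes u∈Γ̂ = ≤-trans (x≤Γ̂ u u∈Γ̂) (m≤m+n _ _)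
    ... | no  _    = ≤-trans (m≤n+m∸n x (codeg u)) (+-monoʳ-≤ (codeg u) (m≤m+n _ 0))

module Walk {n : ℕ} (G : Graph n) {r q : ℕ} (2≤r : 2 ≤ r) (1≤q : 1 ≤ q)
            (turán : codegSum G + r * (q * suc q) ≤ (2 * q + 1) * n) where

  -- x is the codegree of the r-th term.
  record Saturated (vs : List (Fin n)) : Set where
    field
      x        : ℕ
      r≤length : r ≤ length vs
      ≤x       : All (_≤ x) (codegs G (take r vs))
      sum≤n    : sum (codegs G (take r vs)) ≤ n
      bound    : n * x + sumSq (codegs G (take r vs)) ≤ codegSum G + x * sum (codegs G (take r vs))

  saturated : ∀ pre v rest → suc (length pre) ≡ r → All (_≤ codeg G v) (codegs G pre) →
    sum (codegs G pre) + codeg G v ≤ n →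
    n * codeg G v + sumSq (codegs G pre) ≤ codegSum G + codeg G v * sum (codegs G pre) →
    Saturated (pre ++ v ∷ rest)
  saturated pre v rest refl pre≤x S+x≤n bound = record
    { x        = x
    ; r≤length = subst (suc (length pre) ≤_) (sym (length-++-sucʳ pre v rest)) (s≤s (length-++-≤ˡ pre))
    ; ≤x       = subst (All (_≤ x)) (sym prefix≡) (++⁺ pre≤x (≤-refl ∷ []))
    ; sum≤n    = subst (λ l → sum l ≤ n) (sym prefix≡) (subst (_≤ n) (sym (sum-∷ʳ (codegs G pre) x)) S+x≤n)
    ; bound    = subst (λ l → n * x + sumSq l ≤ codegSum G + x * sum l) (sym prefix≡)
                       (n*x+sumSq≤N+x*sum-∷ʳ {n} (codegs G pre) bound)
    }
    where
    x = codeg G v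
    prefix≡ : codegs G (take (suc (length pre)) (pre ++ v ∷ rest)) ≡ codegs G pre ++ [ x ]
    prefix≡ = trans (cong (codegs G) (take-suc-length-++ pre v rest)) (map-++ (codeg G) pre [ v ])

  walk : ∀ pre rest → Greedy G pre rest → GreedyPrefix G pre → sum (codegs G pre) < n → length pre < r →
    Saturated (pre ++ rest)
  -- Γ̂(pre) is empty, so the bound holds with x = n, which leaves no room for a nonempty prefix.
  walk pre [] empty inv S<n pre<r
    with prefix-step (codegs G pre) 1≤q turán (subst (_< r) (sym (length-codegs G pre)) pre<r) S<n
           (n*x+sumSq≤codegSum+x*sum G inv (λ u u∈Γ̂ → contradiction u∈Γ̂ (empty u))
                                      (all-codegs G (λ u → m∸n≤m n (deg G u)) pre))
  ... | inj₁ S+n<n          = contradiction S+n<n (m+n≮n _ n)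
  ... | inj₂ (S+n≡n , full) = contradiction (+-monoˡ-≤ n (nonempty pre full)) (<-irrefl (sym S+n≡n))
    where
    nonempty : ∀ pre → suc (length (codegs G pre)) ≡ r → 1 ≤ sum (codegs G pre)
    nonempty []      1≡r = contradiction (subst (2 ≤_) (sym 1≡r) 2≤r) λ { (s≤s ()) }
    nonempty (p ∷ _) _   = ≤-trans (1≤codeg G p) (m≤m+n _ _)
  walk pre (v ∷ rest) (v∈Γ̂ , v-max , greedy) inv S<n pre<r =
    continue (prefix-step (codegs G pre) 1≤q turán (subst (_< r) (sym (length-codegs G pre)) pre<r) S<n bound)
    where
    x = codeg G v
    pre≤x : All (_≤ x) (codegs G pre)
    pre≤x = map⁺ (All.map (codeg-antitone G) (GreedyPrefix.dominated inv v v∈Γ̂))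
    bound : n * x + sumSq (codegs G pre) ≤ codegSum G + x * sum (codegs G pre)
    bound = n*x+sumSq≤codegSum+x*sum G inv (λ u u∈Γ̂ → codeg-antitone G (v-max u u∈Γ̂)) pre≤x
    continue : sum (codegs G pre) + x < n ⊎ (sum (codegs G pre) + x ≡ n × suc (length (codegs G pre)) ≡ r) →
      Saturated (pre ++ v ∷ rest)
    continue (inj₂ (S+x≡n , full)) =
      saturated pre v rest (trans (cong suc (sym (length-codegs G pre))) full) pre≤x (≤-reflexive S+x≡n) bound
    continue (inj₁ S+x<n) with suc (length pre) ≟ r
    ... | yes full = saturated pre v rest full pre≤x (<⇒≤ S+x<n) bound
    ... | no  ¬full = subst Saturated (++-assoc pre [ v ] rest)
                        (walk (pre ++ [ v ]) rest greedy (greedyPrefix-∷ʳ G inv (λ w → v-max w))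
                          (subst (_< n) (sym S′≡) S+x<n) (subst (_< r) (sym len′≡) (≤∧≢⇒< pre<r ¬full)))
      where
      S′≡ : sum (codegs G (pre ++ [ v ])) ≡ sum (codegs G pre) + x
      S′≡ = trans (cong sum (map-++ (codeg G) pre [ v ])) (sum-∷ʳ (codegs G pre) x)
      len′≡ : length (pre ++ [ v ]) ≡ suc (length pre)
      len′≡ = trans (length-++-sucʳ pre v []) (cong (suc ∘ length) (++-identityʳ pre))

theorem2 : (r n : ℕ) → 2 ≤ r → r ≤ n → (G : Graph n) → turan r n ≤ edges G → ¬ Regular G →
    Σ (List (Fin n)) (λ vs → PSeq G vs × r ≤ length vs
    × 2 * r * edges G < n * sum (map (deg G) (take r vs)))
theorem2 (suc zero) _ (s≤s ()) _ _ _ _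
theorem2 r@(suc r′@(suc _)) n 2≤r r≤n G t≤m irregular with pSeq-exists G
... | [] , empty = contradiction [] (empty (fromℕ< 0<n))
  where 0<n = <-≤-trans z<s r≤n
... | vs@(a ∷ rest) , greedy@(_ , a-max , _) = vs , greedy , r≤length , degree-bound
  where
  open Walk G 2≤r (m≥n⇒m/n>0 r≤n) (codegSum+r*q[1+q]≤[2q+1]*n G {q = n / r} t≤m (TuránCount.turan-identity r′ n))
  open Saturated (walk [] vs greedy (greedyPrefix-[] G) (<-≤-trans z<s r≤n) z<s)
  length-prefix : length (take r vs) ≡ r
  length-prefix = trans (length-take r vs) (m≤n⇒m⊓n≡m r≤length)
  codeg-bound : n * sum (codegs G (take r vs)) < r * codegSum G
  codeg-bound = subst (λ k → n * sum (codegs G (take r vs)) < k * codegSum G)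
                      (trans (length-codegs G (take r vs)) length-prefix)
    (n*sum<length*N (codeg G a) (codegs G (take r′ rest))
                    (all-codegs G (λ w → codeg-antitone G (a-max w [])) (take r′ rest))
                    ≤x sum≤n bound (n*codeg<codegSum G (λ w → a-max w []) irregular))
  degree-bound : 2 * r * edges G < n * sum (map (deg G) (take r vs))
  degree-bound = 2*r*m<n*D {n} {r} {edges G} {codegSum G} codeg-bound (codegSum+2*edges≡n*n G)
                   (trans (sum-codegs+sum-degs G (take r vs)) (cong (_* n) length-prefix))
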